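{- Let $G=(X\,\dot\cup\,Y,E)$ be a finite bipartite graph and let $X=X_S\,\dot\cup\,X_L$ and $Y=Y_S\,\dot\cup\,Y_L$ be any partitions such that (a) there are no edges between $X_S$ and $Y_L$; (b) $G[X_S,Y_S]$ is $Y$-path-saturated; (c) $G[X_L,Y_L]$ admits a matching saturating $X_L$. Then: (d) $G[X_L,Y_L]$ admits a matching saturating $X_L$, and every such matching is an envy-free matching in $G$; (e) every envy-free matching in $G$ is contained in $G[X_L,Y_L]$.
   Context: For a matching $M$, $X_M,Y_M$ denote the vertices of $X,Y$ covered by $M$; $M$ is \emph{envy-free} (with respect to $X$) if no vertex of $X\setminus X_M$ is adjacent to any vertex of $Y_M$. $G[X',Y']$ is the induced subgraph on $X'\,\dot\cup\,Y'$. A bipartite graph $H=(A\,\dot\cup\,B,F)$ ($A$ the $X$-side) is \emph{$Y$-path-saturated} if for some integer $k\ge1$ there are partitions $A=A_0\,\dot\cup\cdots\dot\cup\,A_k$, $B=B_1\,\dot\cup\cdots\dot\cup\,B_k$ (parts may be empty) such that for all $i\ge1$ there is a perfect matching between $A_i$ and $B_i$ and every vertex of $B_i$ has a neighbour in $A_{i-1}$. -}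

module Defs where

open import Data.Nat using (ℕ; suc; _≤_)
open import Data.Fin using (Fin)
open import Data.Bool using (Bool; true; false)
open import Data.Product using (Σ; ∃; ∃-syntax; _×_)
open import Relation.Nullary using (¬_)
open import Relation.Binary.PropositionalEquality using (_≡_)

Graph : ℕ → ℕ → Set₁
Graph m n = Fin m → Fin n → Set

InS : ∀ {k} → (Fin k → Bool) → Fin k → Set
InS p v = p v ≡ true

InL : ∀ {k} → (Fin k → Bool) → Fin k → Set
InL p v = p v ≡ false

Induced : ∀ {m n} → Graph m n → (Fin m → Set) → (Fin n → Set) → Graph m n
Induced E X' Y' x y = X' x × Y' y × E x y

IsMatching : ∀ {m n} → Graph m n → (Fin m → Fin n → Set) → Set
IsMatching E M =
  (∀ x y → M x y → E x y) ×
  (∀ x y y′ → M x y → M x y′ → y ≡ y′) ×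
  (∀ x x′ y → M x y → M x′ y → x ≡ x′)

CoveredX : ∀ {m n} → (Fin m → Fin n → Set) → Fin m → Set
CoveredX M x = ∃[ y ] M x y

CoveredY : ∀ {m n} → (Fin m → Fin n → Set) → Fin n → Set
CoveredY M y = ∃[ x ] M x y

Saturates : ∀ {m n} → (Fin m → Fin n → Set) → (Fin m → Set) → Set
Saturates M X' = ∀ x → X' x → CoveredX M x

IsEnvyFree : ∀ {m n} → Graph m n → (Fin m → Fin n → Set) → Set
IsEnvyFree E M =
  IsMatching E M ×
  (∀ x y → ¬ CoveredX M x → CoveredY M y → ¬ E x y)

PerfectMatchingBetween : ∀ {m n} → Graph m n → (Fin m → Set) → (Fin n → Set)
                       → (Fin m → Fin n → Set) → Set
PerfectMatchingBetween E A′ B′ N =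
  IsMatching (Induced E A′ B′) N ×
  (∀ x → A′ x → CoveredX N x) ×
  (∀ y → B′ y → CoveredY N y)

-- H = G[A, B] is Y-path-saturated: there is k ≥ 1 and partitions
-- A = A_0 ∪ … ∪ A_k (vertex x ∈ A lies in A_(a x)),
-- B = B_1 ∪ … ∪ B_k (vertex y ∈ B lies in B_(b y)),
-- such that for 1 ≤ i ≤ k there is a perfect matching between A_i and B_i
-- in H, and every y ∈ B_i has an H-neighbour in A_(i-1).
YPathSaturated : ∀ {m n} → Graph m n → (Fin m → Set) → (Fin n → Set) → Set₁
YPathSaturated {m} {n} E A B =
  Σ ℕ λ k → (1 ≤ k) ×
  Σ (Fin m → ℕ) λ a → Σ (Fin n → ℕ) λ b →
    (∀ x → A x → a x ≤ k) ×
    (∀ y → B y → (1 ≤ b y) × (b y ≤ k)) ×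
    (∀ i → 1 ≤ i → i ≤ k →
       Σ (Fin m → Fin n → Set) λ N →
         PerfectMatchingBetween (Induced E A B)
           (λ x → A x × a x ≡ i) (λ y → B y × b y ≡ i) N) ×
    (∀ y → B y → ∃[ x ] (A x × suc (a x) ≡ b y × E x y))

module Submission where

-- Part (d) is immediate: a matching inside G[X_L, Y_L] that
-- saturates X_L leaves only X_S-vertices unmatched, and these have no edges
-- into Y_L ⊇ Y_M.  For part (e) let M be envy-free and U = X_S ∩ X_M.  The
-- perfect matchings A_i ↔ B_i of the Y-path-saturated graph G[X_S, Y_S] give
-- each y ∈ Y_S an injective, level-preserving partner ρ(y) ∈ X_S adjacent to
-- y.  Vertices of U are matched into Y_S (no X_S–Y_L edges), and by
-- envy-freeness ρ(M(x)) is again matched, so x ↦ ρ(M(x)) is an injective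
-- self-map of the finite set U, hence onto U.  Thus every t ∈ U is ρ(y) for
-- a matched y ∈ B_i with i = level(t), and y has a neighbour in A_(i-1),
-- which is again in U.  This is an infinite descent of levels, so U = ∅;
-- then Y_S ∩ Y_M = ∅ too, as ρ(y) would envy y.  Constructively, the
-- counting step needs U decidable, which holds up to double negation; this
-- suffices because U = ∅ is a negative statement.

open import Defs
open import Data.Nat using (ℕ; zero; suc; _≤_)
open import Data.Nat.Properties using (≤-irrelevant; 1+n≰n; suc-injective)
open import Data.Fin using (Fin; punchOut)
open import Data.Fin.Properties using (any?; _≟_; punchOut-injective; injective⇒≤)
open import Data.Bool using (Bool)
open import Data.Bool.Properties using (¬-not)
open import Data.Product using (Σ; ∃; ∃-syntax; _×_; _,_; proj₁; proj₂)
open import Function.Definitions using (Injective)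
open import Relation.Nullary using (¬_; Dec; yes; no; contradiction)
open import Relation.Nullary.Decidable using (¬¬-excluded-middle; decidable-stable)
open import Relation.Binary.PropositionalEquality
  using (_≡_; _≢_; refl; sym; trans; cong; subst)

-- A family of propositions indexed by a finite set is decidable up to
-- double negation; enough to refute a claim using case distinctions.
¬¬-decidable : ∀ {m} (P : Fin m → Set) → ¬ ¬ (∀ x → Dec (P x))
¬¬-decidable {zero}  P k = k (λ ())
¬¬-decidable {suc m} P k =
  ¬¬-excluded-middle λ P₀? →
  ¬¬-decidable (λ x → P (Fin.suc x)) λ Pₛ? →
  k λ { Fin.zero → P₀? ; (Fin.suc x) → Pₛ? x }

-- An injective self-map of Fin m is surjective: a missed value would let it
-- factor injectively through Fin (m - 1).
injective⇒surjective : ∀ {m} (f : Fin m → Fin m) → Injective _≡_ _≡_ f →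
                       ∀ t → ∃[ x ] f x ≡ t
injective⇒surjective {zero}  f f-inj ()
injective⇒surjective {suc m} f f-inj t with any? (λ x → f x ≟ t)
... | yes hit  = hit
... | no  miss = contradiction (injective⇒≤ squeezed-injective) 1+n≰n
  where
  avoids : ∀ x → t ≢ f x
  avoids x t≡fx = miss (x , sym t≡fx)

  squeezed : Fin (suc m) → Fin m
  squeezed x = punchOut (avoids x)

  squeezed-injective : Injective _≡_ _≡_ squeezed
  squeezed-injective eq = f-inj (punchOut-injective (avoids _) (avoids _) eq)

-- The same for a decidable subset U of Fin m: an injective map from U into
-- U is onto U (extend it by the identity outside U).
subset-injection⇒surjection :
  ∀ {m} {U : Fin m → Set} → (∀ x → Dec (U x)) →
  (f : ∀ x → U x → Fin m) → (∀ x u → U (f x u)) →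
  (∀ {x x′} u u′ → f x u ≡ f x′ u′ → x ≡ x′) →
  ∀ t → U t → ∃[ x ] Σ (U x) λ u → f x u ≡ t
subset-injection⇒surjection {U = U} U? f f-into f-inj t t∈U =
  let x , ex≡t = injective⇒surjective extended extended-injective t
  in preimage x (U? x) ex≡t
  where
  extend : ∀ x → Dec (U x) → Fin _
  extend x (yes u) = f x u
  extend x (no _)  = x

  extend-injective : ∀ {x x′} (d : Dec (U x)) (d′ : Dec (U x′)) →
                     extend x d ≡ extend x′ d′ → x ≡ x′
  extend-injective (yes u) (yes u′) e = f-inj u u′ e
  extend-injective (yes u) (no ∉U′) e = contradiction (subst U e (f-into _ u)) ∉U′
  extend-injective (no ∉U) (yes u′) e = contradiction (subst U (sym e) (f-into _ u′)) ∉U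
  extend-injective (no _)  (no _)   e = e

  extended : Fin _ → Fin _
  extended x = extend x (U? x)

  extended-injective : Injective _≡_ _≡_ extended
  extended-injective {x} {x′} = extend-injective (U? x) (U? x′)

  preimage : ∀ x (d : Dec (U x)) → extend x d ≡ t → ∃[ x ] Σ (U x) λ u → f x u ≡ t
  preimage x (yes u) e = x , u , e
  preimage x (no ∉U) e = contradiction (subst U (sym e) t∈U) ∉U

no-infinite-descent : ∀ {A : Set} (P : A → Set) (rank : A → ℕ) →
  (∀ x → P x → ∃[ w ] P w × suc (rank w) ≡ rank x) → ∀ x → ¬ P x
no-infinite-descent P rank descend x = below (rank x) x refl
  where
  below : ∀ ℓ x → rank x ≡ ℓ → ¬ P x
  below zero    x rx≡0 px with descend x px
  ... | _ , _  , srw≡rx = contradiction (trans srw≡rx rx≡0) λ ()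
  below (suc ℓ) x rx≡sℓ px with descend x px
  ... | w , pw , srw≡rx = below ℓ w (suc-injective (trans srw≡rx rx≡sℓ)) pw

record LevelPartner {m n} (H : Graph m n) (B : Fin n → Set)
                    (a : Fin m → ℕ) (b : Fin n → ℕ) : Set where
  field
    partner           : ∀ y → B y → Fin m
    partner-level     : ∀ y y∈B → a (partner y y∈B) ≡ b y
    partner-edge      : ∀ y y∈B → H (partner y y∈B) y
    partner-injective : ∀ {y y′} y∈B y′∈B → partner y y∈B ≡ partner y′ y′∈B → y ≡ y′

-- Perfect matchings between the levels A_i and B_i (1 ≤ i ≤ k) yield level
-- partners: the partner of y ∈ B_i is its mate in the i-th matching.
levelPartner :
  ∀ {m n} {H : Graph m n} {A : Fin m → Set} {B : Fin n → Set}
    {a : Fin m → ℕ} {b : Fin n → ℕ} k →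
  (∀ y → B y → (1 ≤ b y) × (b y ≤ k)) →
  (∀ i → 1 ≤ i → i ≤ k → Σ (Fin m → Fin n → Set) λ N →
     PerfectMatchingBetween H (λ x → A x × a x ≡ i) (λ y → B y × b y ≡ i) N) →
  LevelPartner H B a b
levelPartner {m} {n} {H} {A} {B} {a} {b} k b-range matchings = record
  { partner           = partner
  ; partner-level     = λ y y∈B → proj₂ (proj₁ (matched-in-level y y∈B))
  ; partner-edge      = λ y y∈B → proj₂ (proj₂ (matched-in-level y y∈B))
  ; partner-injective = partner-injective
  }
  where
  level-of : ∀ y → B y → Σ (Fin m → Fin n → Set) λ N →
    PerfectMatchingBetween H (λ x → A x × a x ≡ b y) (λ y′ → B y′ × b y′ ≡ b y) N
  level-of y y∈B = matchings (b y) (proj₁ (b-range y y∈B)) (proj₂ (b-range y y∈B))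

  N : ∀ y → B y → Fin m → Fin n → Set
  N y y∈B = proj₁ (level-of y y∈B)

  same-level : ∀ {y y′} y∈B y′∈B → b y ≡ b y′ → N y y∈B ≡ N y′ y′∈B
  same-level {y} {y′} y∈B y′∈B = coherent (b-range y y∈B) (b-range y′ y′∈B)
    where
    coherent : ∀ {i j} (r : (1 ≤ i) × (i ≤ k)) (r′ : (1 ≤ j) × (j ≤ k)) → i ≡ j →
               proj₁ (matchings i (proj₁ r) (proj₂ r)) ≡ proj₁ (matchings j (proj₁ r′) (proj₂ r′))
    coherent (p , q) (p′ , q′) refl
      rewrite ≤-irrelevant p p′ | ≤-irrelevant q q′ = refl

  mate : ∀ y y∈B → CoveredY (N y y∈B) y
  mate y y∈B = proj₂ (proj₂ (proj₂ (level-of y y∈B))) y (y∈B , refl)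

  partner : ∀ y → B y → Fin m
  partner y y∈B = proj₁ (mate y y∈B)

  matched-in-level : ∀ y y∈B →
    Induced H (λ x → A x × a x ≡ b y) (λ y′ → B y′ × b y′ ≡ b y) (partner y y∈B) y
  matched-in-level y y∈B = proj₁ (proj₁ (proj₂ (level-of y y∈B))) _ y (proj₂ (mate y y∈B))

  partner-injective : ∀ {y y′} y∈B y′∈B → partner y y∈B ≡ partner y′ y′∈B → y ≡ y′
  partner-injective {y} {y′} y∈B y′∈B p≡p′ =
    proj₁ (proj₂ (proj₁ (proj₂ (level-of y y∈B)))) _ y y′ (proj₂ (mate y y∈B)) y′-mate
    where
    levels : b y ≡ b y′
    levels = trans (sym (proj₂ (proj₁ (matched-in-level y y∈B))))
                   (trans (cong a p≡p′) (proj₂ (proj₁ (matched-in-level y′ y′∈B))))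
    y′-mate : N y y∈B (partner y y∈B) y′
    y′-mate = subst (λ R → R (partner y y∈B) y′) (sym (same-level y∈B y′∈B levels))
                (subst (λ x → N y′ y′∈B x y′) (sym p≡p′) (proj₂ (mate y′ y′∈B)))

envy-free-neighbour : ∀ {m n} {E : Graph m n} {M : Fin m → Fin n → Set} →
  IsEnvyFree E M → ∀ {x y} → E x y → CoveredY M y → ¬ ¬ CoveredX M x
envy-free-neighbour (_ , no-envy) exy y-matched x-unmatched =
  no-envy _ _ x-unmatched y-matched exy

saturating-matching-envy-free :
  ∀ {m n} {E : Graph m n} {X′ : Fin m → Set} {Y′ : Fin n → Set} {M} →
  (∀ x y → ¬ X′ x → Y′ y → ¬ E x y) →
  IsMatching (Induced E X′ Y′) M → Saturates M X′ → IsEnvyFree E M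
saturating-matching-envy-free no-edge (in-G′ , functional , injective) saturates =
  ((λ x y mxy → proj₂ (proj₂ (in-G′ x y mxy))) , functional , injective) ,
  λ x y x-unmatched (x′ , mx′y) →
    no-edge x y (λ x∈X′ → x-unmatched (saturates x x∈X′)) (proj₁ (proj₂ (in-G′ x′ y mx′y)))

envy-free-avoids :
  ∀ {m n} {E : Graph m n} {A : Fin m → Set} {B : Fin n → Set}
    {a : Fin m → ℕ} {b : Fin n → ℕ} →
  (∀ x y → A x → E x y → B y) →
  LevelPartner (Induced E A B) B a b →
  (∀ y → B y → ∃[ x ] (A x × suc (a x) ≡ b y × E x y)) →
  ∀ M → IsEnvyFree E M → ∀ x → A x → ¬ CoveredX M x
envy-free-avoids {m} {E = E} {A} {B} {a} A-into-B P lower M ef@((in-G , _ , injective) , _)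
                 x x∈A x-matched =
  ¬¬-decidable U λ U? → no-infinite-descent U a (descend U?) x (x∈A , x-matched)
  where
  open LevelPartner P

  U : Fin m → Set
  U x = A x × CoveredX M x

  next : ∀ x → U x → Fin m
  next x (x∈A , y , mxy) = partner y (A-into-B x y x∈A (in-G x y mxy))

  next-injective : ∀ {x x′} u u′ → next x u ≡ next x′ u′ → x ≡ x′
  next-injective {x} {x′} (_ , y , mxy) (_ , y′ , mx′y′) e =
    injective x x′ y mxy (subst (M x′) (sym (partner-injective _ _ e)) mx′y′)

  matched-neighbour : (∀ x → Dec (U x)) → ∀ {w y} → A w → E w y → CoveredY M y → U w
  matched-neighbour U? {w} w∈A ewy y-matched = decidable-stable (U? w)
    λ ∉U → envy-free-neighbour ef ewy y-matched λ w-matched → ∉U (w∈A , w-matched)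

  next-in-U : (∀ x → Dec (U x)) → ∀ x u → U (next x u)
  next-in-U U? x (_ , y , mxy) =
    matched-neighbour U? (proj₁ p-edge) (proj₂ (proj₂ p-edge)) (x , mxy)
    where
    p-edge : Induced E A B (next x _) y
    p-edge = partner-edge y _

  descend : (∀ x → Dec (U x)) → ∀ t → U t → ∃[ w ] U w × suc (a w) ≡ a t
  descend U? t t∈U
    with subset-injection⇒surjection U? next (next-in-U U?) next-injective t t∈U
  ... | x , (x∈A , y , mxy) , refl =
    let y∈B = A-into-B x y x∈A (in-G x y mxy)
        w , w∈A , srw≡by , ewy = lower y y∈B
    in w , matched-neighbour U? w∈A ewy (x , mxy) , trans srw≡by (sym (partner-level y y∈B))

-- Consequently such a matching covers no vertex of B either: the level
-- partner of a matched y ∈ B would be unmatched and envy y.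
envy-free-avoids-partners :
  ∀ {m n} {E : Graph m n} {A : Fin m → Set} {B : Fin n → Set}
    {a : Fin m → ℕ} {b : Fin n → ℕ} {M} →
  LevelPartner (Induced E A B) B a b → IsEnvyFree E M →
  (∀ x → A x → ¬ CoveredX M x) → ∀ y → B y → ¬ CoveredY M y
envy-free-avoids-partners {E = E} {A} {B} P (_ , no-envy) A-unmatched y y∈B y-matched =
  no-envy _ y (A-unmatched _ (proj₁ p-edge)) y-matched (proj₂ (proj₂ p-edge))
  where
  open LevelPartner P
  p-edge : Induced E A B (partner y y∈B) y
  p-edge = partner-edge y y∈B

lemma2p3 : ∀ {m n} (E : Graph m n) (XS : Fin m → Bool) (YS : Fin n → Bool) →
    (∀ x y → InS XS x → InL YS y → ¬ E x y) →
    YPathSaturated E (InS XS) (InS YS) →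
    (∃[ M ] (IsMatching (Induced E (InL XS) (InL YS)) M × Saturates M (InL XS))) →
    ((∃[ M ] (IsMatching (Induced E (InL XS) (InL YS)) M × Saturates M (InL XS)))
      × (∀ M → IsMatching (Induced E (InL XS) (InL YS)) M → Saturates M (InL XS) →
           IsEnvyFree E M))
    × (∀ M → IsEnvyFree E M → ∀ x y → M x y → InL XS x × InL YS y)
lemma2p3 E XS YS no-SL-edge (k , _ , a , b , _ , b-range , matchings , lower) L-matching =
  (L-matching , λ M → saturating-matching-envy-free no-edge-into-YL) , inside-L
  where
  no-edge-into-YL : ∀ x y → ¬ InL XS x → InL YS y → ¬ E x y
  no-edge-into-YL x y x∉L = no-SL-edge x y (¬-not x∉L)

  S-into-S : ∀ x y → InS XS x → E x y → InS YS y
  S-into-S x y x∈S exy = ¬-not λ y∈L → no-SL-edge x y x∈S y∈L exy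

  partners : LevelPartner (Induced E (InS XS) (InS YS)) (InS YS) a b
  partners = levelPartner k b-range matchings

  inside-L : ∀ M → IsEnvyFree E M → ∀ x y → M x y → InL XS x × InL YS y
  inside-L M ef x y mxy =
    ¬-not (λ x∈S → XS-unmatched x x∈S (y , mxy)) ,
    ¬-not (λ y∈S → envy-free-avoids-partners partners ef XS-unmatched y y∈S (x , mxy))
    where
    XS-unmatched : ∀ x → InS XS x → ¬ CoveredX M x
    XS-unmatched = envy-free-avoids S-into-S partners lower M ef
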